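{- Let $G_1,G_2$ be graphs with $V(G_1)\cap V(G_2)=\emptyset$, let $v_1\in V(G_1)$, $v_2\in V(G_2)$, and let $G$ be the graph with vertex set $V(G_1)\cup V(G_2)$ and edge set $E(G_1)\cup E(G_2)\cup\{v_1v_2\}$. If $S$ is a tough set of $G$, then $S\subseteq V(G_1)$ or $S\subseteq V(G_2)$.
   Context: For a graph $H$, $c(H)$ denotes its number of components. A set $S\subseteq V(G)$ is a cutset if $c(G-S)>1$. $G$ is $t$-tough if $|S|\ge t\cdot c(G-S)$ for every cutset $S$; the toughness $\tau(G)$ is the largest such $t$, with $\tau(K_n)=\infty$. A tough set of $G$ is a cutset $S$ with $|S|=\tau(G)\cdot c(G-S)$. -}

module Defs where

open import Data.Nat using (ℕ; _+_; _*_; _≤_; _<_)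
open import Data.Fin using (Fin; splitAt; _≟_)
open import Data.Fin.Subset using (Subset; _∈_; _∉_; ∣_∣)
open import Data.Sum using (_⊎_; inj₁; inj₂)
open import Data.Product using (Σ; ∃; _×_; _,_)
open import Relation.Nullary using (¬_; Dec; yes; no)
open import Relation.Nullary.Decidable using (_×-dec_)
open import Relation.Binary.PropositionalEquality using (_≡_; refl)
open import Relation.Binary.Construct.Closure.ReflexiveTransitive using (Star)

record Graph : Set₁ where
  field
    n      : ℕ
    Adj    : Fin n → Fin n → Set
    sym    : ∀ {x y} → Adj x y → Adj y x
    irrefl : ∀ {x} → ¬ Adj x x
    dec    : ∀ x y → Dec (Adj x y)

module _ (G : Graph) where
  open Graph G

  AdjOut : Subset n → Fin n → Fin n → Set
  AdjOut S x y = (x ∉ S) × (y ∉ S) × Adj x y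

  Connected : Subset n → Fin n → Fin n → Set
  Connected S = Star (AdjOut S)

  -- c(G - S) = k : the vertices of G - S are labelled onto Fin k so that
  -- two vertices get the same label iff they lie in the same component.
  record NumComponents (S : Subset n) (k : ℕ) : Set where
    field
      label    : (x : Fin n) → x ∉ S → Fin k
      surj     : ∀ i → ∃ λ x → Σ (x ∉ S) λ p → label x p ≡ i
      sound    : ∀ x y (p : x ∉ S) (q : y ∉ S) → label x p ≡ label y q → Connected S x y
      complete : ∀ x y (p : x ∉ S) (q : y ∉ S) → Connected S x y → label x p ≡ label y q

  IsCutsetWith : Subset n → ℕ → Set
  IsCutsetWith S k = NumComponents S k × (1 < k)

  IsCutset : Subset n → Set
  IsCutset S = ∃ λ k → IsCutsetWith S k

  -- G is (p/q)-tough (q > 0): |T| ≥ (p/q)·c(G-T) for every cutset T,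
  -- i.e. p·c(G-T) ≤ q·|T|.
  IsToughFrac : ℕ → ℕ → Set
  IsToughFrac p q = ∀ T k → IsCutsetWith T k → p * k ≤ q * ∣ T ∣

  -- S is a tough set: S is a cutset and |S| = τ(G)·c(G-S).  Since τ(G) is the
  -- largest t with G t-tough, and S itself forces τ(G) ≤ |S|/c(G-S), this
  -- holds iff G is (|S|/c(G-S))-tough.
  IsToughSet : Subset n → Set
  IsToughSet S = ∃ λ k → IsCutsetWith S k × IsToughFrac ∣ S ∣ k

-- Gluing two disjoint graphs with an extra edge v₁v₂.
-- Vertices of G₁ are Fin n₁ ↪ Fin (n₁ + n₂) via _↑ˡ_, those of G₂ via _↑ʳ_.
module Glue (G₁ G₂ : Graph) (v₁ : Fin (Graph.n G₁)) (v₂ : Fin (Graph.n G₂)) where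
  private
    module A = Graph G₁
    module B = Graph G₂

  Adj' : Fin A.n ⊎ Fin B.n → Fin A.n ⊎ Fin B.n → Set
  Adj' (inj₁ a) (inj₁ b) = A.Adj a b
  Adj' (inj₂ a) (inj₂ b) = B.Adj a b
  Adj' (inj₁ a) (inj₂ b) = (a ≡ v₁) × (b ≡ v₂)
  Adj' (inj₂ b) (inj₁ a) = (a ≡ v₁) × (b ≡ v₂)

  sym' : ∀ u w → Adj' u w → Adj' w u
  sym' (inj₁ a) (inj₁ b) e = A.sym e
  sym' (inj₂ a) (inj₂ b) e = B.sym e
  sym' (inj₁ a) (inj₂ b) e = e
  sym' (inj₂ b) (inj₁ a) e = e

  irrefl' : ∀ u → ¬ Adj' u u
  irrefl' (inj₁ a) = A.irrefl
  irrefl' (inj₂ b) = B.irrefl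

  dec' : ∀ u w → Dec (Adj' u w)
  dec' (inj₁ a) (inj₁ b) = A.dec a b
  dec' (inj₂ a) (inj₂ b) = B.dec a b
  dec' (inj₁ a) (inj₂ b) = (a ≟ v₁) ×-dec (b ≟ v₂)
  dec' (inj₂ b) (inj₁ a) = (a ≟ v₁) ×-dec (b ≟ v₂)

  graph : Graph
  graph = record
    { n      = A.n + B.n
    ; Adj    = λ x y → Adj' (splitAt A.n x) (splitAt A.n y)
    ; sym    = λ {x} {y} → sym' (splitAt A.n x) (splitAt A.n y)
    ; irrefl = λ {x} → irrefl' (splitAt A.n x)
    ; dec    = λ x y → dec' (splitAt A.n x) (splitAt A.n y)
    }

glue : (G₁ G₂ : Graph) → Fin (Graph.n G₁) → Fin (Graph.n G₂) → Graph
glue G₁ G₂ v₁ v₂ = Glue.graph G₁ G₂ v₁ v₂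

-- If a tough set S of the glued graph G, with c(G - S) = k, met both sides,
-- let S₁ and S₂ be its parts in G₁ and G₂.  Contracting G₂ onto v₁ maps paths
-- of G - S₁ to walks of G - S, and contracting G₁ onto v₂ does the same for
-- G - S₂.  So sending each component of G - S to the component of G - S₁ or
-- G - S₂ containing it, according to the side of a chosen vertex, is
-- injective; and it misses the component of G₂ in G - S₁ or that of G₁ in
-- G - S₂, because hitting both would put v₁ and v₂, and hence the edge v₁v₂,
-- outside S.  Thus c(G - S₁) + c(G - S₂) > k while |S₁| + |S₂| = |S|, so one
-- Sᵢ is a cutset with |Sᵢ| / c(G - Sᵢ) < |S| / k = τ(G), a contradiction.

module Submission where

open import Defs
open import Data.Nat using (ℕ; zero; suc; _+_; _*_; _≤_; _≰_; _<_; z≤n; s≤s; _<?_)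
open import Data.Nat.Properties
  using (≤-trans; ≤-reflexive; ≤-pred; <⇒≤; ≤-<-trans; <-irrefl; ≮⇒≥; ≤⇒≯;
         +-mono-≤; +-monoˡ-≤; +-monoʳ-≤; +-comm; +-identityʳ; *-comm; *-suc;
         *-monoʳ-≤; *-monoʳ-<; *-distribˡ-+; m<n+m; m≤m+n; module ≤-Reasoning)
open import Data.Fin using (Fin; zero; suc; _↑ˡ_; _↑ʳ_; splitAt; join; punchOut; _≟_)
open import Data.Fin.Properties
  using (splitAt-↑ˡ; splitAt-↑ʳ; splitAt-join; join-splitAt; injective⇒≤; suc-injective;
         punchOut-injective; punchOut-cong; any?; all?; ¬∀⟶∃¬)
open import Data.Fin.Subset using (Subset; _∈_; _∉_; _⊆_; ∣_∣; ⊥; Nonempty; inside; outside)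
open import Data.Fin.Subset.Properties
  using (_∈?_; ∉⊥; ⊆-refl; ⊆-min; ∣⊥∣≡0; nonempty?; x∈p⇒∣p-x∣<∣p∣)
open import Data.List using (List; []; _∷_; allFin)
open import Data.List.Membership.Propositional using () renaming (_∈_ to _∈ˡ_)
open import Data.List.Membership.Propositional.Properties using (∈-allFin)
open import Data.List.Relation.Unary.Any using (here; there)
open import Data.Product using (Σ; ∃; _×_; _,_; proj₁; proj₂)
open import Data.Sum using (_⊎_; inj₁; inj₂; [_,_]′)
open import Data.Sum.Properties using (inj₁-injective; inj₂-injective)
open import Data.Vec using ([]; _∷_; _++_; here; there)
import Data.Vec as Vec
import Data.Empty as Empty
open import Data.Empty using (⊥-elim)
open import Function using (_∘_; const; id)
open import Function.Definitions using (Injective)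
open import Relation.Nullary using (¬_; Dec; yes; no)
open import Relation.Nullary.Decidable using (_×-dec_; ¬?)
open import Relation.Binary.PropositionalEquality
  using (_≡_; _≢_; refl; sym; trans; cong; cong₂; subst; subst₂; module ≡-Reasoning)
open import Relation.Binary.Construct.Closure.ReflexiveTransitive
  using (Star; ε; _◅_; _◅◅_; gmap; kleisliStar; reverse; return)

-- Subsets of Fin (m + n) as concatenations

data Side (m n : ℕ) : Fin (m + n) → Set where
  left  : (a : Fin m) → Side m n (a ↑ˡ n)
  right : (b : Fin n) → Side m n (m ↑ʳ b)

side : ∀ m {n} (x : Fin (m + n)) → Side m n x
side m {n} x = subst (Side m n) (join-splitAt m n x) (side-of-join (splitAt m x))
  where
  side-of-join : (s : Fin m ⊎ Fin n) → Side m n (join m n s)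
  side-of-join (inj₁ a) = left a
  side-of-join (inj₂ b) = right b

∈-++⁺ˡ : ∀ {m n} {p : Subset m} {q : Subset n} {a} → a ∈ p → (a ↑ˡ n) ∈ p ++ q
∈-++⁺ˡ here       = here
∈-++⁺ˡ (there a∈p) = there (∈-++⁺ˡ a∈p)

∈-++⁻ˡ : ∀ {m n} (p : Subset m) {q : Subset n} {a} → (a ↑ˡ n) ∈ p ++ q → a ∈ p
∈-++⁻ˡ (_ ∷ p) {a = zero}  here = here
∈-++⁻ˡ (_ ∷ p) {a = suc a} (there a∈p) = there (∈-++⁻ˡ p a∈p)

∈-++⁺ʳ : ∀ {m n} (p : Subset m) {q : Subset n} {b} → b ∈ q → (m ↑ʳ b) ∈ p ++ q
∈-++⁺ʳ []      b∈q = b∈q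
∈-++⁺ʳ (_ ∷ p) b∈q = there (∈-++⁺ʳ p b∈q)

∈-++⁻ʳ : ∀ {m n} (p : Subset m) {q : Subset n} {b} → (m ↑ʳ b) ∈ p ++ q → b ∈ q
∈-++⁻ʳ []      b∈q = b∈q
∈-++⁻ʳ (_ ∷ p) (there b∈q) = ∈-++⁻ʳ p b∈q

++-mono-⊆ : ∀ {m n} {p p′ : Subset m} {q q′ : Subset n} → p ⊆ p′ → q ⊆ q′ → p ++ q ⊆ p′ ++ q′
++-mono-⊆ {m} {p = p} {p′} p⊆p′ q⊆q′ {x} x∈p++q with side m x
... | left a  = ∈-++⁺ˡ (p⊆p′ (∈-++⁻ˡ p x∈p++q))
... | right b = ∈-++⁺ʳ p′ (q⊆q′ (∈-++⁻ʳ p x∈p++q))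

∈-++-emptyʳ : ∀ {m n} (p : Subset m) {q : Subset n} → ¬ Nonempty q →
              ∀ {x} → x ∈ p ++ q → ∃ λ a → x ≡ a ↑ˡ n
∈-++-emptyʳ {m} p q-empty {x} x∈p++q with side m x
... | left a  = a , refl
... | right b = ⊥-elim (q-empty (b , ∈-++⁻ʳ p x∈p++q))

∈-++-emptyˡ : ∀ {m n} (p : Subset m) {q : Subset n} → ¬ Nonempty p →
              ∀ {x} → x ∈ p ++ q → ∃ λ b → x ≡ m ↑ʳ b
∈-++-emptyˡ {m} p p-empty {x} x∈p++q with side m x
... | left a  = ⊥-elim (p-empty (a , ∈-++⁻ˡ p x∈p++q))
... | right b = b , refl

∣p++q∣≡∣p∣+∣q∣ : ∀ {m n} (p : Subset m) (q : Subset n) → ∣ p ++ q ∣ ≡ ∣ p ∣ + ∣ q ∣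
∣p++q∣≡∣p∣+∣q∣ []             q = refl
∣p++q∣≡∣p∣+∣q∣ (inside  ∷ p) q = cong suc (∣p++q∣≡∣p∣+∣q∣ p q)
∣p++q∣≡∣p∣+∣q∣ (outside ∷ p) q = ∣p++q∣≡∣p∣+∣q∣ p q

x∈p⇒0<∣p∣ : ∀ {n x} {p : Subset n} → x ∈ p → 0 < ∣ p ∣
x∈p⇒0<∣p∣ x∈p = ≤-trans (s≤s z≤n) (x∈p⇒∣p-x∣<∣p∣ x∈p)

-- Counting by injections

avoids⇒< : ∀ {m n} {f : Fin m → Fin n} → Injective _≡_ _≡_ f →
           (z : Fin n) → (∀ i → f i ≢ z) → m < n
avoids⇒< {n = suc _} f-injective z f≢z =
  s≤s (injective⇒≤ (f-injective ∘ punchOut-injective (f≢z _ ∘ sym) (f≢z _ ∘ sym)))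

avoids-one-of⇒< : ∀ {m n} {f : Fin m → Fin n} → Injective _≡_ _≡_ f →
                  (z₁ z₂ : Fin n) → (∀ {i j} → f i ≡ z₁ → f j ≢ z₂) → m < n
avoids-one-of⇒< {f = f} f-injective z₁ z₂ not-both with any? (λ i → f i ≟ z₁)
... | yes (i , fi≡z₁) = avoids⇒< f-injective z₂ (λ j → not-both fi≡z₁)
... | no z₁-missed    = avoids⇒< f-injective z₁ (λ i fi≡z₁ → z₁-missed (i , fi≡z₁))

join-injective : ∀ m n → Injective _≡_ _≡_ (join m n)
join-injective m n {s} {t} eq = begin
  s                      ≡⟨ sym (splitAt-join m n s) ⟩
  splitAt m (join m n s) ≡⟨ cong (splitAt m) eq ⟩
  splitAt m (join m n t) ≡⟨ splitAt-join m n t ⟩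
  t                      ∎
  where open ≡-Reasoning

-- Connected components

connected-∉ : ∀ {G T x y} → Connected G T x y → x ∉ T → y ∉ T
connected-∉     ε                      x∉T = x∉T
connected-∉ {G} ((_ , z∉T , _) ◅ path) _   = connected-∉ {G} path z∉T

≡⇒Connected : ∀ {G T x y} → x ≡ y → Connected G T x y
≡⇒Connected refl = ε

module Components (G : Graph) where
  open Graph G renaming (sym to Adj-sym)
  open import Data.List.Membership.DecPropositional (_≟_ {n}) using () renaming (_∈?_ to _∈ˡ?_)

  InducedAdj : (Fin n → Set) → Fin n → Fin n → Set
  InducedAdj P x y = P x × P y × Adj x y

  InducedAdj-sym : ∀ {P : Fin n → Set} {x y} → InducedAdj P x y → InducedAdj P y x
  InducedAdj-sym (p , q , e) = q , p , Adj-sym e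

  record ComponentLabelling (P : Fin n → Set) (m : ℕ) : Set where
    field
      label    : ∀ x → P x → Fin m
      sound    : ∀ x y (p : P x) (q : P y) → label x p ≡ label y q → Star (InducedAdj P) x y
      complete : ∀ x y (p : P x) (q : P y) → Star (InducedAdj P) x y → label x p ≡ label y q

    label-irrelevant : ∀ x (p q : P x) → label x p ≡ label x q
    label-irrelevant x p q = complete x x p q ε

    Used : Fin m → Set
    Used i = ∃ λ x → Σ (P x) λ p → label x p ≡ i

    used? : (∀ x → Dec (P x)) → ∀ i → Dec (Used i)
    used? P? i = any? used-at?
      where
      used-at? : ∀ x → Dec (Σ (P x) λ p → label x p ≡ i)
      used-at? x with P? x
      ... | no ¬p = no (¬p ∘ proj₁)
      ... | yes p with label x p ≟ i
      ...   | yes eq = yes (p , eq)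
      ...   | no neq = no λ (p′ , eq) → neq (trans (label-irrelevant x p p′) eq)

  open ComponentLabelling

  empty-labelling : ∀ {P : Fin n → Set} → (∀ x → ¬ P x) → ComponentLabelling P 0
  empty-labelling ¬P = record
    { label    = λ x p → ⊥-elim (¬P x p)
    ; sound    = λ x _ p _ _ → ⊥-elim (¬P x p)
    ; complete = λ x _ p _ _ → ⊥-elim (¬P x p)
    }

  labelling-resp : ∀ {P Q : Fin n → Set} {m} → (∀ {x} → P x → Q x) → (∀ {x} → Q x → P x) →
                   ComponentLabelling P m → ComponentLabelling Q m
  labelling-resp P⇒Q Q⇒P L = record
    { label    = λ x q → label L x (Q⇒P q)
    ; sound    = λ x y p q eq → gmap id (adj-resp P⇒Q) (sound L x y (Q⇒P p) (Q⇒P q) eq)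
    ; complete = λ x y p q path → complete L x y (Q⇒P p) (Q⇒P q) (gmap id (adj-resp Q⇒P) path)
    }
    where
    adj-resp : ∀ {P Q : Fin n → Set} → (∀ {x} → P x → Q x) → ∀ {x y} → InducedAdj P x y → InducedAdj Q x y
    adj-resp P⇒Q (p , q , e) = P⇒Q p , P⇒Q q , e

  -- Adding the vertex x merges x with all components adjacent to it under the
  -- new label zero; every other component i is relabelled suc i.
  module Extend {P : Fin n → Set} (P? : ∀ x → Dec (P x)) {x} (x∉P : ¬ P x)
                {m} (L : ComponentLabelling P m) where

    P⁺ : Fin n → Set
    P⁺ y = P y ⊎ y ≡ x

    Touched : Fin m → Set
    Touched i = ∃ λ z → Σ (P z) λ p → Adj x z × label L z p ≡ i

    touched? : ∀ i → Dec (Touched i)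
    touched? i = any? touched-at?
      where
      touched-at? : ∀ z → Dec (Σ (P z) λ p → Adj x z × label L z p ≡ i)
      touched-at? z with P? z
      ... | no ¬p = no (¬p ∘ proj₁)
      ... | yes p with dec x z | label L z p ≟ i
      ...   | yes e  | yes eq = yes (p , e , eq)
      ...   | no ¬e  | _      = no λ (_ , e , _) → ¬e e
      ...   | yes _  | no neq = no λ (p′ , _ , eq) → neq (trans (label-irrelevant L z p p′) eq)

    merge : Fin m → Fin (suc m)
    merge i with touched? i
    ... | yes _ = zero
    ... | no _  = suc i

    merge-touched : ∀ {i} → Touched i → merge i ≡ zero
    merge-touched {i} t with touched? i
    ... | yes _ = refl
    ... | no ¬t = ⊥-elim (¬t t)

    merge-untouched : ∀ {i} → ¬ Touched i → merge i ≡ suc i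
    merge-untouched {i} ¬t with touched? i
    ... | yes t = ⊥-elim (¬t t)
    ... | no _  = refl

    label⁺ : ∀ y → P⁺ y → Fin (suc m)
    label⁺ y (inj₁ p) = merge (label L y p)
    label⁺ y (inj₂ _) = zero

    label⁺-irrelevant : ∀ y (a b : P⁺ y) → label⁺ y a ≡ label⁺ y b
    label⁺-irrelevant y (inj₁ p)    (inj₁ q)    = cong merge (label-irrelevant L y p q)
    label⁺-irrelevant y (inj₁ p)    (inj₂ refl) = ⊥-elim (x∉P p)
    label⁺-irrelevant y (inj₂ refl) (inj₁ q)    = ⊥-elim (x∉P q)
    label⁺-irrelevant y (inj₂ refl) (inj₂ refl) = refl

    label⁺-edge : ∀ {y u} (a : P⁺ y) (b : P⁺ u) → Adj y u → label⁺ y a ≡ label⁺ u b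
    label⁺-edge (inj₁ p)    (inj₁ q)    e = cong merge (complete L _ _ p q (return (p , q , e)))
    label⁺-edge (inj₁ p)    (inj₂ refl) e = merge-touched (_ , p , Adj-sym e , refl)
    label⁺-edge (inj₂ refl) (inj₁ q)    e = sym (merge-touched (_ , q , e , refl))
    label⁺-edge (inj₂ refl) (inj₂ refl) e = refl

    complete⁺ : ∀ y w (a : P⁺ y) (b : P⁺ w) → Star (InducedAdj P⁺) y w → label⁺ y a ≡ label⁺ w b
    complete⁺ y .y a b ε = label⁺-irrelevant y a b
    complete⁺ y w a b ((a′ , c , e) ◅ path) =
      trans (label⁺-irrelevant y a a′) (trans (label⁺-edge a′ c e) (complete⁺ _ w c b path))

    lift : ∀ {y w} → Star (InducedAdj P) y w → Star (InducedAdj P⁺) y w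
    lift = gmap id λ (p , q , e) → inj₁ p , inj₁ q , e

    label⁺-cases : ∀ y (a : P⁺ y) →
                   (label⁺ y a ≡ zero × Star (InducedAdj P⁺) y x)
                   ⊎ (Σ (P y) λ p → label⁺ y a ≡ suc (label L y p))
    label⁺-cases y (inj₂ refl) = inj₁ (refl , ε)
    label⁺-cases y (inj₁ p) = by-touch (touched? (label L y p))
      where
      by-touch : Dec (Touched (label L y p)) →
                 (label⁺ y (inj₁ p) ≡ zero × Star (InducedAdj P⁺) y x)
                 ⊎ (Σ (P y) λ p′ → label⁺ y (inj₁ p) ≡ suc (label L y p′))
      by-touch (yes t@(z , q , e , eq)) =
        inj₁ (merge-touched t , lift (sound L y z p q (sym eq)) ◅◅ return (inj₁ q , inj₂ refl , Adj-sym e))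
      by-touch (no ¬t) = inj₂ (p , merge-untouched ¬t)

    sound⁺ : ∀ y w (a : P⁺ y) (b : P⁺ w) → label⁺ y a ≡ label⁺ w b → Star (InducedAdj P⁺) y w
    sound⁺ y w a b eq with label⁺-cases y a | label⁺-cases w b
    ... | inj₁ (_ , y⇝x) | inj₁ (_ , w⇝x) = y⇝x ◅◅ reverse InducedAdj-sym w⇝x
    ... | inj₁ (y↦0 , _) | inj₂ (_ , w↦s) with () ← trans (sym y↦0) (trans eq w↦s)
    ... | inj₂ (_ , y↦s) | inj₁ (w↦0 , _) with () ← trans (sym y↦s) (trans eq w↦0)
    ... | inj₂ (p , y↦s) | inj₂ (q , w↦s) =
      lift (sound L y w p q (suc-injective (trans (sym y↦s) (trans eq w↦s))))

    extend : ComponentLabelling P⁺ (suc m)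
    extend = record { label = label⁺ ; sound = sound⁺ ; complete = complete⁺ }

  open Extend using (extend)

  skip : ∀ {P : Fin n → Set} {x xs m} → (P x → x ∈ˡ xs) →
         ComponentLabelling (λ y → P y × y ∈ˡ xs) m →
         ComponentLabelling (λ y → P y × y ∈ˡ x ∷ xs) m
  skip {P} {x} {xs} covered = labelling-resp {λ y → P y × y ∈ˡ xs} {λ y → P y × y ∈ˡ x ∷ xs}
    (λ (p , y∈xs) → p , there y∈xs)
    (λ { (p , here refl) → p , covered p ; (p , there y∈xs) → p , y∈xs })

  labelling-within : ∀ {P : Fin n → Set} → (∀ x → Dec (P x)) → (xs : List (Fin n)) →
                     ∃ (ComponentLabelling (λ y → P y × y ∈ˡ xs))
  labelling-within P? [] = 0 , empty-labelling λ _ ()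
  labelling-within {P} P? (x ∷ xs) with labelling-within P? xs | P? x | x ∈ˡ? xs
  ... | m , L | yes p | no x∉xs = suc m , add p (extend (λ y → P? y ×-dec y ∈ˡ? xs) (x∉xs ∘ proj₂) L)
    where
    add : ∀ {m} → P x → ComponentLabelling (λ y → (P y × y ∈ˡ xs) ⊎ y ≡ x) m →
          ComponentLabelling (λ y → P y × y ∈ˡ x ∷ xs) m
    add p = labelling-resp {λ y → (P y × y ∈ˡ xs) ⊎ y ≡ x} {λ y → P y × y ∈ˡ x ∷ xs}
      (λ { (inj₁ (q , y∈xs)) → q , there y∈xs ; (inj₂ refl) → p , here refl })
      (λ { (q , here refl) → inj₂ refl ; (q , there y∈xs) → inj₁ (q , y∈xs) })
  ... | m , L | yes _ | yes x∈xs = m , skip (λ _ → x∈xs) L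
  ... | m , L | no ¬p | _        = m , skip (⊥-elim ∘ ¬p) L

  labelling : ∀ {P : Fin n → Set} → (∀ x → Dec (P x)) → ∃ (ComponentLabelling P)
  labelling {P} P? with labelling-within P? (allFin n)
  ... | m , L = m , labelling-resp {λ y → P y × y ∈ˡ allFin n} {P} proj₁ (λ p → p , ∈-allFin _) L

  drop-unused : ∀ {P : Fin n → Set} {m} (L : ComponentLabelling P (suc m)) (i : Fin (suc m)) →
                ¬ Used L i → ComponentLabelling P m
  drop-unused L i unused = record
    { label    = λ x p → punchOut {i = i} {j = label L x p} λ i≡ → unused (x , p , sym i≡)
    ; sound    = λ x y p q eq → sound L x y p q (punchOut-injective {i = i} _ _ eq)
    ; complete = λ x y p q path → punchOut-cong i (complete L x y p q path)
    }

  numComponents-of : ∀ {S m} (L : ComponentLabelling (_∉ S) m) → (∀ i → Used L i) →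
                     NumComponents G S m
  numComponents-of L all-used = record
    { label = label L ; surj = all-used ; sound = sound L ; complete = complete L }

  compact : ∀ {S m} → ComponentLabelling (_∉ S) m → ∃ (NumComponents G S)
  compact {m = zero}  L = 0 , numComponents-of L λ ()
  compact {S} {suc m} L with all? (used? L λ x → ¬? (x ∈? S))
  ... | yes all-used = suc m , numComponents-of L all-used
  ... | no some-unused with ¬∀⟶∃¬ _ _ (used? L λ x → ¬? (x ∈? S)) some-unused
  ...   | i , unused = compact (drop-unused L i unused)

numComponents : ∀ G S → ∃ (NumComponents G S)
numComponents G S = compact (proj₂ (labelling λ x → ¬? (x ∈? S)))
  where open Components G

-- The toughness ratio

one-sided-split : ∀ {s₁ s₂ k k₂} → 0 < s₁ → 0 < k → k ≤ k₂ → (s₁ + s₂) * k₂ ≰ k * s₂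
one-sided-split {s₁} {s₂} {k} {k₂} 0<s₁ (s≤s _) k≤k₂ tough₂ = <-irrefl refl (begin-strict
  s * k  ≤⟨ *-monoʳ-≤ s k≤k₂ ⟩
  s * k₂ ≤⟨ tough₂ ⟩
  k * s₂ <⟨ *-monoʳ-< k (m<n+m s₂ 0<s₁) ⟩
  k * s  ≡⟨ *-comm k s ⟩
  s * k  ∎)
  where
  open ≤-Reasoning
  s = s₁ + s₂

-- kᵢ ≤ 1 ⊎ s * kᵢ ≤ k * sᵢ is what (s/k)-toughness says about a vertex set
-- of size sᵢ whose deletion leaves kᵢ components.
no-ratio-preserving-split : ∀ {s₁ s₂ k k₁ k₂} → 0 < s₁ → 0 < s₂ → 1 < k → k < k₁ + k₂ →
                            k₁ ≤ 1 ⊎ (s₁ + s₂) * k₁ ≤ k * s₁ →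
                            k₂ ≤ 1 ⊎ (s₁ + s₂) * k₂ ≤ k * s₂ → Empty.⊥
no-ratio-preserving-split _ _ 1<k k<k₁+k₂ (inj₁ k₁≤1) (inj₁ k₂≤1) =
  ≤⇒≯ (+-mono-≤ k₁≤1 k₂≤1) (≤-<-trans 1<k k<k₁+k₂)
no-ratio-preserving-split {k₂ = k₂} 0<s₁ _ 1<k k<k₁+k₂ (inj₁ k₁≤1) (inj₂ tough₂) =
  one-sided-split 0<s₁ (<⇒≤ 1<k) (≤-pred (≤-trans k<k₁+k₂ (+-monoˡ-≤ k₂ k₁≤1))) tough₂
no-ratio-preserving-split {s₁} {s₂} {k} {k₁} _ 0<s₂ 1<k k<k₁+k₂ (inj₂ tough₁) (inj₁ k₂≤1) =
  one-sided-split 0<s₂ (<⇒≤ 1<k) k≤k₁ (subst (λ s → s * k₁ ≤ k * s₁) (+-comm s₁ s₂) tough₁)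
  where
  k≤k₁ : k ≤ k₁
  k≤k₁ = ≤-pred (≤-trans k<k₁+k₂ (≤-trans (+-monoʳ-≤ k₁ k₂≤1) (≤-reflexive (+-comm k₁ 1))))
no-ratio-preserving-split {s₁} {s₂} {k} {k₁} {k₂} 0<s₁ _ _ k<k₁+k₂ (inj₂ tough₁) (inj₂ tough₂) =
  <-irrefl refl (begin-strict
    s * k             <⟨ m<n+m (s * k) (≤-trans 0<s₁ (m≤m+n s₁ s₂)) ⟩
    s + s * k         ≡⟨ sym (*-suc s k) ⟩
    s * suc k         ≤⟨ *-monoʳ-≤ s k<k₁+k₂ ⟩
    s * (k₁ + k₂)     ≡⟨ *-distribˡ-+ s k₁ k₂ ⟩
    s * k₁ + s * k₂   ≤⟨ +-mono-≤ tough₁ tough₂ ⟩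
    k * s₁ + k * s₂   ≡⟨ sym (*-distribˡ-+ k s₁ s₂) ⟩
    k * s             ≡⟨ *-comm k s ⟩
    s * k             ∎)
  where
  open ≤-Reasoning
  s = s₁ + s₂

-- The glued graph

module Glued (G₁ G₂ : Graph) (v₁ : Fin (Graph.n G₁)) (v₂ : Fin (Graph.n G₂)) where
  private
    n₁ = Graph.n G₁
    n₂ = Graph.n G₂

  G : Graph
  G = glue G₁ G₂ v₁ v₂

  open Graph G using (Adj) renaming (sym to Adj-sym)
  open Glue G₁ G₂ v₁ v₂ using (Adj')

  V₁ V₂ : Fin (n₁ + n₂)
  V₁ = v₁ ↑ˡ n₂
  V₂ = n₁ ↑ʳ v₂

  bridge : Adj V₁ V₂
  bridge = subst₂ Adj' (sym (splitAt-↑ˡ n₁ v₁ n₂)) (sym (splitAt-↑ʳ n₁ n₂ v₂)) (refl , refl)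

  bridge-ends : ∀ {a b} → Adj (a ↑ˡ n₂) (n₁ ↑ʳ b) → a ≡ v₁ × b ≡ v₂
  bridge-ends {a} {b} = subst₂ Adj' (splitAt-↑ˡ n₁ a n₂) (splitAt-↑ʳ n₁ n₂ b)

  retract₁ retract₂ : Fin (n₁ + n₂) → Fin (n₁ + n₂)
  retract₁ = [ _↑ˡ n₂ , const V₁ ]′ ∘ splitAt n₁
  retract₂ = [ const V₂ , n₁ ↑ʳ_ ]′ ∘ splitAt n₁

  retract₁-↑ˡ : ∀ a → retract₁ (a ↑ˡ n₂) ≡ a ↑ˡ n₂
  retract₁-↑ˡ a = cong [ _↑ˡ n₂ , const V₁ ]′ (splitAt-↑ˡ n₁ a n₂)

  retract₁-↑ʳ : ∀ b → retract₁ (n₁ ↑ʳ b) ≡ V₁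
  retract₁-↑ʳ b = cong [ _↑ˡ n₂ , const V₁ ]′ (splitAt-↑ʳ n₁ n₂ b)

  retract₂-↑ˡ : ∀ a → retract₂ (a ↑ˡ n₂) ≡ V₂
  retract₂-↑ˡ a = cong [ const V₂ , n₁ ↑ʳ_ ]′ (splitAt-↑ˡ n₁ a n₂)

  retract₂-↑ʳ : ∀ b → retract₂ (n₁ ↑ʳ b) ≡ n₁ ↑ʳ b
  retract₂-↑ʳ b = cong [ const V₂ , n₁ ↑ʳ_ ]′ (splitAt-↑ʳ n₁ n₂ b)

  retract₁-bridge : ∀ {a b} → Adj (a ↑ˡ n₂) (n₁ ↑ʳ b) → retract₁ (a ↑ˡ n₂) ≡ retract₁ (n₁ ↑ʳ b)
  retract₁-bridge {a} {b} e = begin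
    retract₁ (a ↑ˡ n₂) ≡⟨ retract₁-↑ˡ a ⟩
    a ↑ˡ n₂            ≡⟨ cong (_↑ˡ n₂) (proj₁ (bridge-ends e)) ⟩
    V₁                 ≡⟨ sym (retract₁-↑ʳ b) ⟩
    retract₁ (n₁ ↑ʳ b) ∎
    where open ≡-Reasoning

  retract₂-bridge : ∀ {a b} → Adj (a ↑ˡ n₂) (n₁ ↑ʳ b) → retract₂ (a ↑ˡ n₂) ≡ retract₂ (n₁ ↑ʳ b)
  retract₂-bridge {a} {b} e = begin
    retract₂ (a ↑ˡ n₂) ≡⟨ retract₂-↑ˡ a ⟩
    V₂                 ≡⟨ cong (n₁ ↑ʳ_) (sym (proj₂ (bridge-ends e))) ⟩
    n₁ ↑ʳ b            ≡⟨ sym (retract₂-↑ʳ b) ⟩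
    retract₂ (n₁ ↑ʳ b) ∎
    where open ≡-Reasoning

  module Split (L : Subset n₁) (R : Subset n₂) where

    S S₁ S₂ : Subset (n₁ + n₂)
    S  = L ++ R
    S₁ = L ++ ⊥
    S₂ = ⊥ ++ R

    S₁⊆S : S₁ ⊆ S
    S₁⊆S = ++-mono-⊆ ⊆-refl (⊆-min R)

    S₂⊆S : S₂ ⊆ S
    S₂⊆S = ++-mono-⊆ (⊆-min L) ⊆-refl

    V₂∉S₁ : V₂ ∉ S₁
    V₂∉S₁ = ∉⊥ ∘ ∈-++⁻ʳ L

    V₁∉S₂ : V₁ ∉ S₂
    V₁∉S₂ = ∉⊥ ∘ ∈-++⁻ˡ ⊥

    ∣S₁∣+∣S₂∣≡∣S∣ : ∣ S₁ ∣ + ∣ S₂ ∣ ≡ ∣ S ∣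
    ∣S₁∣+∣S₂∣≡∣S∣ = begin
      ∣ S₁ ∣ + ∣ S₂ ∣
        ≡⟨ cong₂ _+_ (∣p++q∣≡∣p∣+∣q∣ L ⊥) (∣p++q∣≡∣p∣+∣q∣ (⊥ {n₁}) R) ⟩
      (∣ L ∣ + ∣ ⊥ {n₂} ∣) + (∣ ⊥ {n₁} ∣ + ∣ R ∣)
        ≡⟨ cong₂ (λ a b → (∣ L ∣ + a) + (b + ∣ R ∣)) (∣⊥∣≡0 n₂) (∣⊥∣≡0 n₁) ⟩
      (∣ L ∣ + 0) + ∣ R ∣
        ≡⟨ cong (_+ ∣ R ∣) (+-identityʳ ∣ L ∣) ⟩
      ∣ L ∣ + ∣ R ∣
        ≡⟨ sym (∣p++q∣≡∣p∣+∣q∣ L R) ⟩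
      ∣ S ∣ ∎
      where open ≡-Reasoning

    retract₁-edge : ∀ {x y} → AdjOut G S₁ x y → Connected G S (retract₁ x) (retract₁ y)
    retract₁-edge {x} {y} (x∉S₁ , y∉S₁ , e) with side n₁ x | side n₁ y
    ... | left a  | left a′  = subst₂ (Connected G S) (sym (retract₁-↑ˡ a)) (sym (retract₁-↑ˡ a′))
                                 (return (x∉S₁ ∘ ∈-++⁺ˡ ∘ ∈-++⁻ˡ L , y∉S₁ ∘ ∈-++⁺ˡ ∘ ∈-++⁻ˡ L , e))
    ... | left a  | right b  = ≡⇒Connected {G} (retract₁-bridge e)
    ... | right b | left a   = ≡⇒Connected {G} (sym (retract₁-bridge (Adj-sym e)))
    ... | right b | right b′ = ≡⇒Connected {G} (trans (retract₁-↑ʳ b) (sym (retract₁-↑ʳ b′)))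

    retract₂-edge : ∀ {x y} → AdjOut G S₂ x y → Connected G S (retract₂ x) (retract₂ y)
    retract₂-edge {x} {y} (x∉S₂ , y∉S₂ , e) with side n₁ x | side n₁ y
    ... | right b | right b′ = subst₂ (Connected G S) (sym (retract₂-↑ʳ b)) (sym (retract₂-↑ʳ b′))
                                 (return (x∉S₂ ∘ ∈-++⁺ʳ ⊥ ∘ ∈-++⁻ʳ L , y∉S₂ ∘ ∈-++⁺ʳ ⊥ ∘ ∈-++⁻ʳ L , e))
    ... | left a  | right b  = ≡⇒Connected {G} (retract₂-bridge e)
    ... | right b | left a   = ≡⇒Connected {G} (sym (retract₂-bridge (Adj-sym e)))
    ... | left a  | left a′  = ≡⇒Connected {G} (trans (retract₂-↑ˡ a) (sym (retract₂-↑ˡ a′)))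

    retract₁-connected : ∀ {x y} → Connected G S₁ x y → Connected G S (retract₁ x) (retract₁ y)
    retract₁-connected = kleisliStar retract₁ retract₁-edge

    retract₂-connected : ∀ {x y} → Connected G S₂ x y → Connected G S (retract₂ x) (retract₂ y)
    retract₂-connected = kleisliStar retract₂ retract₂-edge

    module Count {k k₁ k₂} (C : NumComponents G S k)
                 (C₁ : NumComponents G S₁ k₁) (C₂ : NumComponents G S₂ k₂) where
      private
        module C  = NumComponents C
        module C₁ = NumComponents C₁
        module C₂ = NumComponents C₂

      side-label : ∀ x → x ∉ S → Fin k₁ ⊎ Fin k₂
      side-label x x∉S with side n₁ x
      ... | left _  = inj₁ (C₁.label _ (x∉S ∘ S₁⊆S))
      ... | right _ = inj₂ (C₂.label _ (x∉S ∘ S₂⊆S))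

      side-label≡inj₁ : ∀ {x y} (p : x ∉ S) (q : y ∉ S₁) →
                        side-label x p ≡ inj₁ (C₁.label y q) → Connected G S x (retract₁ y)
      side-label≡inj₁ {x} p q eq with side n₁ x
      ... | left a = subst (λ z → Connected G S z _) (retract₁-↑ˡ a)
                       (retract₁-connected (C₁.sound _ _ _ q (inj₁-injective eq)))
      side-label≡inj₁ p q () | right _

      side-label≡inj₂ : ∀ {x y} (p : x ∉ S) (q : y ∉ S₂) →
                        side-label x p ≡ inj₂ (C₂.label y q) → Connected G S x (retract₂ y)
      side-label≡inj₂ {x} p q eq with side n₁ x
      ... | right b = subst (λ z → Connected G S z _) (retract₂-↑ʳ b)
                        (retract₂-connected (C₂.sound _ _ _ q (inj₂-injective eq)))
      side-label≡inj₂ p q () | left _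

      side-label-injective : ∀ {x y} (p : x ∉ S) (q : y ∉ S) →
                             side-label x p ≡ side-label y q → C.label x p ≡ C.label y q
      side-label-injective {x} {y} p q eq with side n₁ y
      ... | left b  = C.complete _ _ p q (subst (Connected G S x) (retract₁-↑ˡ b) (side-label≡inj₁ p _ eq))
      ... | right b = C.complete _ _ p q (subst (Connected G S x) (retract₂-↑ʳ b) (side-label≡inj₂ p _ eq))

      rep : Fin k → Fin (n₁ + n₂)
      rep i = proj₁ (C.surj i)

      rep∉S : ∀ i → rep i ∉ S
      rep∉S i = proj₁ (proj₂ (C.surj i))

      label-rep : ∀ i → C.label (rep i) (rep∉S i) ≡ i
      label-rep i = proj₂ (proj₂ (C.surj i))

      embed : Fin k → Fin (k₁ + k₂)
      embed i = join k₁ k₂ (side-label (rep i) (rep∉S i))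

      embed-injective : Injective _≡_ _≡_ embed
      embed-injective {i} {j} eq = begin
        i                           ≡⟨ sym (label-rep i) ⟩
        C.label (rep i) (rep∉S i)   ≡⟨ side-label-injective _ _ (join-injective k₁ k₂ eq) ⟩
        C.label (rep j) (rep∉S j)   ≡⟨ label-rep j ⟩
        j                           ∎
        where open ≡-Reasoning

      -- The two hits would be components of G - S containing v₁ and v₂ respectively,
      -- hence equal by the edge v₁v₂, yet lying on different sides.
      misses-one-of : ∀ {i j} → embed i ≡ join k₁ k₂ (inj₁ (C₁.label V₂ V₂∉S₁)) →
                      embed j ≢ join k₁ k₂ (inj₂ (C₂.label V₁ V₁∉S₂))
      misses-one-of {i} {j} eq₁ eq₂ =
        inj₁≢inj₂ (join-injective k₁ k₂ (trans (sym eq₁) (trans (cong embed i≡j) eq₂)))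
        where
        inj₁≢inj₂ : ∀ {a b} → inj₁ a ≢ inj₂ b
        inj₁≢inj₂ ()

        i⇝V₁ : Connected G S (rep i) V₁
        i⇝V₁ = subst (Connected G S (rep i)) (retract₁-↑ʳ v₂) (side-label≡inj₁ _ _ (join-injective k₁ k₂ eq₁))

        j⇝V₂ : Connected G S (rep j) V₂
        j⇝V₂ = subst (Connected G S (rep j)) (retract₂-↑ˡ v₁) (side-label≡inj₂ _ _ (join-injective k₁ k₂ eq₂))

        V₁∉S : V₁ ∉ S
        V₁∉S = connected-∉ {G} i⇝V₁ (rep∉S i)

        V₂∉S : V₂ ∉ S
        V₂∉S = connected-∉ {G} j⇝V₂ (rep∉S j)

        i≡j : i ≡ j
        i≡j = begin
          i                         ≡⟨ sym (label-rep i) ⟩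
          C.label (rep i) (rep∉S i) ≡⟨ C.complete _ _ _ _ i⇝V₁ ⟩
          C.label V₁ V₁∉S           ≡⟨ C.complete _ _ _ _ (return (V₁∉S , V₂∉S , bridge)) ⟩
          C.label V₂ V₂∉S           ≡⟨ sym (C.complete _ _ _ _ j⇝V₂) ⟩
          C.label (rep j) (rep∉S j) ≡⟨ label-rep j ⟩
          j                         ∎
          where open ≡-Reasoning

      count : k < k₁ + k₂
      count = avoids-one-of⇒< embed-injective _ _ misses-one-of

    tough-set-one-sided : IsToughSet G S → ¬ (Nonempty L × Nonempty R)
    tough-set-one-sided (k , (C , 1<k) , tough) ((a , a∈L) , (b , b∈R))
      with numComponents G S₁ | numComponents G S₂
    ... | k₁ , C₁ | k₂ , C₂ =
      no-ratio-preserving-split (x∈p⇒0<∣p∣ (∈-++⁺ˡ a∈L)) (x∈p⇒0<∣p∣ (∈-++⁺ʳ (⊥ {n₁}) b∈R)) 1<k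
        (Count.count C C₁ C₂) (ratio-bound C₁) (ratio-bound C₂)
      where
      ratio-bound : ∀ {T k′} → NumComponents G T k′ → k′ ≤ 1 ⊎ (∣ S₁ ∣ + ∣ S₂ ∣) * k′ ≤ k * ∣ T ∣
      ratio-bound {T} {k′} C′ with 1 <? k′
      ... | yes 1<k′ = inj₂ (subst (λ s → s * k′ ≤ k * ∣ T ∣) (sym ∣S₁∣+∣S₂∣≡∣S∣) (tough T k′ (C′ , 1<k′)))
      ... | no 1≮k′  = inj₁ (≮⇒≥ 1≮k′)

lemma2p4 : (G₁ G₂ : Graph) (v₁ : Fin (Graph.n G₁)) (v₂ : Fin (Graph.n G₂))
    (S : Subset (Graph.n G₁ + Graph.n G₂)) →
    IsToughSet (glue G₁ G₂ v₁ v₂) S →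
    (∀ x → x ∈ S → ∃ λ a → x ≡ a ↑ˡ Graph.n G₂)
    ⊎ (∀ x → x ∈ S → ∃ λ b → x ≡ Graph.n G₁ ↑ʳ b)
lemma2p4 G₁ G₂ v₁ v₂ S tough with Vec.splitAt (Graph.n G₁) S
... | L , R , refl with nonempty? L | nonempty? R
...   | _          | no R-empty = inj₁ λ x → ∈-++-emptyʳ L R-empty
...   | no L-empty | _          = inj₂ λ x → ∈-++-emptyˡ L L-empty
...   | yes L≠∅    | yes R≠∅    = ⊥-elim (tough-set-one-sided tough (L≠∅ , R≠∅))
  where open Glued.Split G₁ G₂ v₁ v₂ L R
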